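{- Let $k\ge1$ and let $S_k$ be the star graph with one internal node and $k$ leaves. Then the spectrum of $\mathrm{CNL}(S_k)$ is $\{0^2,k^{k-1}\}$ and $LE_{CN}(S_k)=\frac{4k(k-1)}{k+1}$. Moreover, $S_k$ is not CNL-hyperenergetic.
   Context: Spectra are multisets, $x^a$ meaning eigenvalue $x$ of multiplicity $a$. For a finite simple graph $\mathcal{G}$ on vertices $v_1,\dots,v_p$: $\mathrm{CN}(\mathcal{G})$ has $(i,j)$-entry $|N(v_i)\cap N(v_j)|$ for $i\neq j$ (open neighbourhoods) and $0$ on the diagonal; $\mathrm{CNRS}(\mathcal{G})$ is the diagonal matrix of row sums of $\mathrm{CN}(\mathcal{G})$; $\mathrm{CNL}(\mathcal{G})=\mathrm{CNRS}(\mathcal{G})-\mathrm{CN}(\mathcal{G})$. $LE_{CN}(\mathcal{G})=\sum_\nu|\nu-tr(\mathrm{CNRS}(\mathcal{G}))/p|$ over the eigenvalues $\nu$ of $\mathrm{CNL}(\mathcal{G})$ with multiplicity. $\mathcal{G}$ on $p$ vertices is CNL-hyperenergetic if $LE_{CN}(\mathcal{G})>LE_{CN}(K_p)$. -}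

module Defs where

open import Data.Bool using (Bool; true; false; _∧_; not; if_then_else_)
open import Data.Nat as ℕ using (ℕ; zero; suc)
open import Data.Fin using (Fin; zero; suc; toℕ; punchIn; _≟_)
open import Data.Integer using (+_)
open import Data.Rational using (ℚ; 0ℚ; 1ℚ; _+_; _*_; _-_; -_; ∣_∣; _/_; _<_)
open import Data.List using (List; []; _∷_; map; allFin; length; foldr)
open import Data.Product using (Σ; ∃; ∃₂; _×_; _,_)
open import Relation.Binary.PropositionalEquality using (_≡_)
open import Relation.Nullary.Decidable using (⌊_⌋)

record SimpleGraph (n : ℕ) : Set where
  field
    Adj    : Fin n → Fin n → Bool
    sym    : ∀ i j → Adj i j ≡ Adj j i
    irrefl : ∀ i → Adj i i ≡ false
open SimpleGraph public

Matrix : Set → ℕ → Set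
Matrix A n = Fin n → Fin n → A

sumℚ : List ℚ → ℚ
sumℚ = foldr _+_ 0ℚ

prodℚ : List ℚ → ℚ
prodℚ = foldr _*_ 1ℚ

sumℕ : List ℕ → ℕ
sumℕ = foldr ℕ._+_ 0

ΣFin : (n : ℕ) → (Fin n → ℚ) → ℚ
ΣFin n f = sumℚ (map f (allFin n))

eqᵇ : {n : ℕ} → Fin n → Fin n → Bool
eqᵇ i j = ⌊ i ≟ j ⌋

ℕtoℚ : ℕ → ℚ
ℕtoℚ m = + m / 1

commonNbrs : {n : ℕ} → SimpleGraph n → Fin n → Fin n → ℕ
commonNbrs {n} G i j =
  sumℕ (map (λ v → if Adj G i v ∧ Adj G v j then 1 else 0) (allFin n))

CN : {n : ℕ} → SimpleGraph n → Matrix ℕ n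
CN G i j = if eqᵇ i j then 0 else commonNbrs G i j

-- row sums of CN(G)  (diagonal entries of CNRS(G))
CNrowSum : {n : ℕ} → SimpleGraph n → Fin n → ℕ
CNrowSum {n} G i = sumℕ (map (CN G i) (allFin n))

trCNRS : {n : ℕ} → SimpleGraph n → ℕ
trCNRS {n} G = sumℕ (map (CNrowSum G) (allFin n))

CNL : {n : ℕ} → SimpleGraph n → Matrix ℚ n
CNL G i j =
  (if eqᵇ i j then ℕtoℚ (CNrowSum G i) else 0ℚ) - ℕtoℚ (CN G i j)

sign : ℕ → ℚ
sign zero = 1ℚ
sign (suc m) = - sign m

det : (n : ℕ) → Matrix ℚ n → ℚ
det zero M = 1ℚ
det (suc n) M =
  ΣFin (suc n) (λ j → sign (toℕ j) * (M zero j * det n (λ a b → M (suc a) (punchIn j b))))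

charPolyAt : {n : ℕ} → Matrix ℚ n → ℚ → ℚ
charPolyAt {n} M x = det n (λ i j → (if eqᵇ i j then x else 0ℚ) - M i j)

-- νs is the spectrum (eigenvalues with algebraic multiplicity) of M:
-- det(x I - M) = ∏_{ν ∈ νs} (x - ν) as polynomials (equivalently, as
-- functions on the infinite field ℚ).
IsSpectrum : {n : ℕ} → Matrix ℚ n → List ℚ → Set
IsSpectrum {n} M νs =
  (length νs ≡ n) × (∀ x → charPolyAt M x ≡ prodℚ (map (λ ν → x - ν) νs))

HasLE_CN : {m : ℕ} → SimpleGraph (suc m) → ℚ → Set
HasLE_CN {m} G e =
  Σ (List ℚ) λ νs → IsSpectrum (CNL G) νs ×
    (e ≡ sumℚ (map (λ ν → ∣ ν - (+ trCNRS G / suc m) ∣) νs))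

complete : (p : ℕ) → SimpleGraph p
complete p = record
  { Adj = λ i j → not (eqᵇ i j)
  ; sym = symK
  ; irrefl = irrK }
  where
  open import Relation.Binary.PropositionalEquality using (refl; cong)
  open import Relation.Nullary using (yes; no)
  symK : ∀ (i j : Fin p) → not (eqᵇ i j) ≡ not (eqᵇ j i)
  symK i j with i ≟ j | j ≟ i
  ... | yes _ | yes _ = refl
  ... | no _ | no _ = refl
  ... | yes refl | no q = Data.Empty.⊥-elim (q refl)
    where import Data.Empty
  ... | no q | yes refl = Data.Empty.⊥-elim (q refl)
    where import Data.Empty
  irrK : ∀ (i : Fin p) → not (eqᵇ i i) ≡ false
  irrK i with i ≟ i
  ... | yes _ = refl
  ... | no q = Data.Empty.⊥-elim (q refl)
    where import Data.Empty

CNLHyperenergetic : {m : ℕ} → SimpleGraph (suc m) → Set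
CNLHyperenergetic {m} G =
  ∃₂ λ e₁ e₂ → HasLE_CN G e₁ × HasLE_CN (complete (suc m)) e₂ × (e₂ < e₁)

starAdj : {k : ℕ} → Fin (suc k) → Fin (suc k) → Bool
starAdj zero zero = false
starAdj zero (suc _) = true
starAdj (suc _) zero = true
starAdj (suc _) (suc _) = false

star : (k : ℕ) → SimpleGraph (suc k)
star k = record { Adj = starAdj ; sym = s ; irrefl = r }
  where
  open import Relation.Binary.PropositionalEquality using (refl)
  s : ∀ (i j : Fin (suc k)) → starAdj i j ≡ starAdj j i
  s zero zero = refl
  s zero (suc _) = refl
  s (suc _) zero = refl
  s (suc _) (suc _) = refl
  r : ∀ (i : Fin (suc k)) → starAdj i i ≡ false
  r zero = refl
  r (suc _) = refl

-- CN(S_k) vanishes on the row and column of the centre and is J − I on the k leaves, while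
-- CN(K_p) = (p − 2)(J − I).  So xI − CNL(S_k) is x ⊕ ((x − k)I + J) and xI − CNL(K_p) is
-- (x − p(p − 2))I + (p − 2)J, and both characteristic polynomials follow from
-- det(aI + bJ) = aⁿ⁻¹(a + nb).  That formula is derived from the first-row Laplace expansion
-- using only linearity in a column and the vanishing of determinants with two equal adjacent
-- columns.  A spectrum is a list determined by the characteristic polynomial only up to order,
-- but when the polynomial is (x − r)ᴬ(x − s)ᴮ the multiplicities are forced, so every spectrum
-- gives the same energy: LE(S_k) = 2c + (k − 1)(k − c) = 4k(k − 1)/(k + 1) with
-- c = k(k − 1)/(k + 1), whereas LE(K_{k+1}) = 2k(k − 1) ≥ 4k(k − 1)/(k + 1).

module Submission where

open import Defs
open import Data.Nat using (ℕ; suc; _≤_; _*_; _∸_)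
open import Data.Integer using (+_)
open import Data.Rational using (0ℚ; _/_)
open import Data.List using (replicate; _++_)
open import Data.Product using (_×_)
open import Relation.Nullary using (¬_)

open import Level using (0ℓ)
open import Function using (_∘_; id)
open import Data.Empty using (⊥-elim)
open import Data.Bool using (true; false; if_then_else_; not; _∧_)
open import Data.Sum using (_⊎_; inj₁; inj₂)
open import Data.Product using (Σ; _,_)
open import Data.Nat as ℕ using (zero; _≡ᵇ_)
import Data.Nat.Properties as ℕ
open import Data.Nat.Coprimality using (1-coprimeTo) renaming (sym to coprime-sym)
import Data.Integer as ℤ
import Data.Integer.Properties as ℤ
open import Data.Fin as Fin using (Fin; zero; suc; toℕ; inject₁; punchIn; punchOut; fromℕ<; _≟_)
import Data.Fin.Properties as Fin
open import Data.List using (List; []; _∷_; map; allFin; length)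
import Data.List.Properties as List
open import Data.List.Relation.Unary.All as All using (All; []; _∷_)
open import Data.List.Relation.Unary.Any using (here; there)
open import Data.List.Membership.Propositional using (_∈_)
open import Data.Rational as ℚ using (ℚ; 1ℚ; _+_; _-_; -_; ∣_∣; mkℚ; 1/_)
  renaming (_*_ to _·_; _≤_ to _≤ℚ_)
import Data.Rational.Properties as ℚ
import Data.Rational.Unnormalised as ℚᵘ
import Data.Rational.Unnormalised.Properties as ℚᵘ
open import Algebra.Bundles using (CommutativeRing)
open import Algebra.Properties.Group ℚ.+-0-group using (x∙y⁻¹≈ε⇒x≈y)
open import Relation.Binary.PropositionalEquality
  using (_≡_; _≢_; refl; trans; cong; cong₂; subst; subst₂; module ≡-Reasoning)
import Relation.Binary.PropositionalEquality as ≡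
open import Relation.Nullary using (Dec; yes; no; does)
open import Relation.Nullary.Decidable using (dec⇒maybe; dec-true; dec-false; isYes≗does; ⌊⌋-map′)
open import Tactic.RingSolver using (solve-∀)
import Data.Nat.Tactic.RingSolver as ℕ-Solver
open import Tactic.RingSolver.Core.AlmostCommutativeRing using (AlmostCommutativeRing; fromCommutativeRing)
open import Algebra.Properties.CommutativeSemiring.Exp
  (CommutativeRing.commutativeSemiring ℚ.+-*-commutativeRing) using (_^_; ^-homo-*; ^-distrib-*)

ℚ-ring : AlmostCommutativeRing 0ℓ 0ℓ
ℚ-ring = fromCommutativeRing ℚ.+-*-commutativeRing (λ x → dec⇒maybe (0ℚ ℚ.≟ x))

map-allFin-suc : ∀ {A : Set} n (f : Fin (suc n) → A) →
  map f (allFin (suc n)) ≡ f zero ∷ map (f ∘ suc) (allFin n)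
map-allFin-suc n f =
  cong (f zero ∷_) (trans (List.map-tabulate suc f) (≡.sym (List.map-tabulate id (f ∘ suc))))

ΣFin-suc : ∀ n (f : Fin (suc n) → ℚ) → ΣFin (suc n) f ≡ f zero + ΣFin n (f ∘ suc)
ΣFin-suc n f = cong sumℚ (map-allFin-suc n f)

ΣFin-cong : ∀ n {f g : Fin n → ℚ} → (∀ j → f j ≡ g j) → ΣFin n f ≡ ΣFin n g
ΣFin-cong n f≗g = cong sumℚ (List.map-cong f≗g (allFin n))

ΣFin-zero : ∀ n (f : Fin n → ℚ) → (∀ j → f j ≡ 0ℚ) → ΣFin n f ≡ 0ℚ
ΣFin-zero zero    f f≗0 = refl
ΣFin-zero (suc n) f f≗0 = begin
  ΣFin (suc n) f                ≡⟨ ΣFin-suc n f ⟩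
  f zero + ΣFin n (f ∘ suc)     ≡⟨ cong₂ _+_ (f≗0 zero) (ΣFin-zero n (f ∘ suc) (f≗0 ∘ suc)) ⟩
  0ℚ + 0ℚ                       ≡⟨⟩
  0ℚ                            ∎
  where open ≡-Reasoning

ΣFin-linear : ∀ n (α β : ℚ) (f g : Fin n → ℚ) →
  ΣFin n (λ j → α · f j + β · g j) ≡ α · ΣFin n f + β · ΣFin n g
ΣFin-linear zero    α β f g = identity α β
  where
  identity : ∀ α β → 0ℚ ≡ α · 0ℚ + β · 0ℚ
  identity = solve-∀ ℚ-ring
ΣFin-linear (suc n) α β f g = begin
  ΣFin (suc n) (λ j → α · f j + β · g j)
    ≡⟨ ΣFin-suc n (λ j → α · f j + β · g j) ⟩
  (α · f zero + β · g zero) + ΣFin n (λ j → α · f (suc j) + β · g (suc j))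
    ≡⟨ cong (_+_ (α · f zero + β · g zero)) (ΣFin-linear n α β (f ∘ suc) (g ∘ suc)) ⟩
  (α · f zero + β · g zero) + (α · ΣFin n (f ∘ suc) + β · ΣFin n (g ∘ suc))
    ≡⟨ regroup α β (f zero) (g zero) (ΣFin n (f ∘ suc)) (ΣFin n (g ∘ suc)) ⟩
  α · (f zero + ΣFin n (f ∘ suc)) + β · (g zero + ΣFin n (g ∘ suc))
    ≡⟨ ≡.sym (cong₂ (λ x y → α · x + β · y) (ΣFin-suc n f) (ΣFin-suc n g)) ⟩
  α · ΣFin (suc n) f + β · ΣFin (suc n) g
    ∎
  where
  open ≡-Reasoning
  regroup : ∀ α β a b c d → (α · a + β · b) + (α · c + β · d) ≡ α · (a + c) + β · (b + d)
  regroup = solve-∀ ℚ-ring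

ΣFinℕ : (n : ℕ) → (Fin n → ℕ) → ℕ
ΣFinℕ n f = sumℕ (map f (allFin n))

ΣFinℕ-suc : ∀ n (f : Fin (suc n) → ℕ) → ΣFinℕ (suc n) f ≡ f zero ℕ.+ ΣFinℕ n (f ∘ suc)
ΣFinℕ-suc n f = cong sumℕ (map-allFin-suc n f)

ΣFinℕ-cong : ∀ n {f g : Fin n → ℕ} → (∀ j → f j ≡ g j) → ΣFinℕ n f ≡ ΣFinℕ n g
ΣFinℕ-cong n f≗g = cong sumℕ (List.map-cong f≗g (allFin n))

ΣFinℕ-const : ∀ n {f : Fin n → ℕ} c → (∀ j → f j ≡ c) → ΣFinℕ n f ≡ n * c
ΣFinℕ-const zero    c f≗c = refl
ΣFinℕ-const (suc n) {f} c f≗c =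
  trans (ΣFinℕ-suc n f) (cong₂ ℕ._+_ (f≗c zero) (ΣFinℕ-const n c (f≗c ∘ suc)))

ΣFinℕ-zero : ∀ n {f : Fin n → ℕ} → (∀ j → f j ≡ 0) → ΣFinℕ n f ≡ 0
ΣFinℕ-zero n f≗0 = trans (ΣFinℕ-const n 0 f≗0) (ℕ.*-zeroʳ n)

ΣFinℕ-+ : ∀ n (f g : Fin n → ℕ) → ΣFinℕ n (λ j → f j ℕ.+ g j) ≡ ΣFinℕ n f ℕ.+ ΣFinℕ n g
ΣFinℕ-+ zero    f g = refl
ΣFinℕ-+ (suc n) f g = begin
  ΣFinℕ (suc n) (λ j → f j ℕ.+ g j)
    ≡⟨ ΣFinℕ-suc n (λ j → f j ℕ.+ g j) ⟩
  (f zero ℕ.+ g zero) ℕ.+ ΣFinℕ n (λ j → f (suc j) ℕ.+ g (suc j))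
    ≡⟨ cong ((f zero ℕ.+ g zero) ℕ.+_) (ΣFinℕ-+ n (f ∘ suc) (g ∘ suc)) ⟩
  (f zero ℕ.+ g zero) ℕ.+ (ΣFinℕ n (f ∘ suc) ℕ.+ ΣFinℕ n (g ∘ suc))
    ≡⟨ interchange (f zero) (g zero) (ΣFinℕ n (f ∘ suc)) (ΣFinℕ n (g ∘ suc)) ⟩
  (f zero ℕ.+ ΣFinℕ n (f ∘ suc)) ℕ.+ (g zero ℕ.+ ΣFinℕ n (g ∘ suc))
    ≡⟨ ≡.sym (cong₂ ℕ._+_ (ΣFinℕ-suc n f) (ΣFinℕ-suc n g)) ⟩
  ΣFinℕ (suc n) f ℕ.+ ΣFinℕ (suc n) g
    ∎
  where
  open ≡-Reasoning
  interchange : ∀ a b c d → (a ℕ.+ b) ℕ.+ (c ℕ.+ d) ≡ (a ℕ.+ c) ℕ.+ (b ℕ.+ d)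
  interchange = ℕ-Solver.solve-∀

eqᵇ-suc : ∀ {n} (a b : Fin n) → eqᵇ (suc a) (suc b) ≡ eqᵇ a b
eqᵇ-suc a b = ⌊⌋-map′ _ _ (a ≟ b)

eqᵇ-refl : ∀ {n} (a : Fin n) → eqᵇ a a ≡ true
eqᵇ-refl a = trans (isYes≗does (a ≟ a)) (dec-true (a ≟ a) refl)

eqᵇ-≢ : ∀ {n} {a b : Fin n} → a ≢ b → eqᵇ a b ≡ false
eqᵇ-≢ {a = a} {b} a≢b = trans (isYes≗does (a ≟ b)) (dec-false (a ≟ b) a≢b)

ΣFinℕ-indicator : ∀ n (a : Fin n) → ΣFinℕ n (λ j → if eqᵇ j a then 1 else 0) ≡ 1
ΣFinℕ-indicator (suc n) zero =
  trans (ΣFinℕ-suc n (λ j → if eqᵇ j zero then 1 else 0)) (cong suc (ΣFinℕ-zero n (λ _ → refl)))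
ΣFinℕ-indicator (suc n) (suc a) =
  trans (ΣFinℕ-suc n (λ j → if eqᵇ j (suc a) then 1 else 0))
    (trans (ΣFinℕ-cong n (λ j → cong (λ e → if e then 1 else 0) (eqᵇ-suc j a)))
      (ΣFinℕ-indicator n a))

ΣFinℕ-off-diagonal : ∀ n (a : Fin (suc n)) c →
  ΣFinℕ (suc n) (λ j → if eqᵇ a j then 0 else c) ≡ n * c
ΣFinℕ-off-diagonal n zero c =
  trans (ΣFinℕ-suc n (λ j → if eqᵇ zero j then 0 else c)) (ΣFinℕ-const n c (λ _ → refl))
ΣFinℕ-off-diagonal (suc n) (suc a) c =
  trans (ΣFinℕ-suc (suc n) (λ j → if eqᵇ (suc a) j then 0 else c))
    (cong (c ℕ.+_) (trans (ΣFinℕ-cong (suc n) (λ j → cong (λ e → if e then 0 else c) (eqᵇ-suc a j)))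
      (ΣFinℕ-off-diagonal n a c)))

ℕtoℚ≡mkℚ : ∀ m → ℕtoℚ m ≡ mkℚ (+ m) 0 (coprime-sym (1-coprimeTo m))
ℕtoℚ≡mkℚ m = ℚ.↥p/↧p≡p (mkℚ (+ m) 0 (coprime-sym (1-coprimeTo m)))

ℕtoℚ-suc : ∀ m → ℕtoℚ (suc m) ≡ 1ℚ + ℕtoℚ m
ℕtoℚ-suc m = ≡.sym (trans (cong (_+_ 1ℚ) (ℕtoℚ≡mkℚ m))
  (ℚ./-cong (cong (ℤ._+_ (+ 1)) (ℤ.*-identityʳ (+ m))) refl))

ℕtoℚ-+ : ∀ m n → ℕtoℚ (m ℕ.+ n) ≡ ℕtoℚ m + ℕtoℚ n
ℕtoℚ-+ zero    n = ≡.sym (ℚ.+-identityˡ (ℕtoℚ n))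
ℕtoℚ-+ (suc m) n = begin
  ℕtoℚ (suc (m ℕ.+ n))     ≡⟨ ℕtoℚ-suc (m ℕ.+ n) ⟩
  1ℚ + ℕtoℚ (m ℕ.+ n)      ≡⟨ cong (_+_ 1ℚ) (ℕtoℚ-+ m n) ⟩
  1ℚ + (ℕtoℚ m + ℕtoℚ n)   ≡⟨ ≡.sym (ℚ.+-assoc 1ℚ (ℕtoℚ m) (ℕtoℚ n)) ⟩
  (1ℚ + ℕtoℚ m) + ℕtoℚ n   ≡⟨ cong (_+ ℕtoℚ n) (≡.sym (ℕtoℚ-suc m)) ⟩
  ℕtoℚ (suc m) + ℕtoℚ n    ∎
  where open ≡-Reasoning

ℕtoℚ-* : ∀ m n → ℕtoℚ (m * n) ≡ ℕtoℚ m · ℕtoℚ n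
ℕtoℚ-* zero    n = ≡.sym (ℚ.*-zeroˡ (ℕtoℚ n))
ℕtoℚ-* (suc m) n = begin
  ℕtoℚ (n ℕ.+ m * n)           ≡⟨ ℕtoℚ-+ n (m * n) ⟩
  ℕtoℚ n + ℕtoℚ (m * n)        ≡⟨ cong (_+_ (ℕtoℚ n)) (ℕtoℚ-* m n) ⟩
  ℕtoℚ n + ℕtoℚ m · ℕtoℚ n     ≡⟨ distrib (ℕtoℚ n) (ℕtoℚ m) ⟩
  (1ℚ + ℕtoℚ m) · ℕtoℚ n       ≡⟨ cong (_· ℕtoℚ n) (≡.sym (ℕtoℚ-suc m)) ⟩
  ℕtoℚ (suc m) · ℕtoℚ n        ∎
  where
  open ≡-Reasoning
  distrib : ∀ x y → x + y · x ≡ (1ℚ + y) · x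
  distrib = solve-∀ ℚ-ring

ℕtoℚ-linear : ∀ a x b y → ℕtoℚ a · ℕtoℚ x + ℕtoℚ b · ℕtoℚ y ≡ ℕtoℚ (a * x ℕ.+ b * y)
ℕtoℚ-linear a x b y = ≡.sym (trans (ℕtoℚ-+ (a * x) (b * y)) (cong₂ _+_ (ℕtoℚ-* a x) (ℕtoℚ-* b y)))

ℕtoℚ-injective : ∀ {m n} → ℕtoℚ m ≡ ℕtoℚ n → m ≡ n
ℕtoℚ-injective {m} {n} eq =
  ℤ.+-injective (cong ℚ.ℚ.numerator (trans (≡.sym (ℕtoℚ≡mkℚ m)) (trans eq (ℕtoℚ≡mkℚ n))))

ℕtoℚ-mono-≤ : ∀ {m n} → m ℕ.≤ n → ℕtoℚ m ≤ℚ ℕtoℚ n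
ℕtoℚ-mono-≤ {m} {n} m≤n = subst₂ _≤ℚ_ (≡.sym (ℕtoℚ≡mkℚ m)) (≡.sym (ℕtoℚ≡mkℚ n))
  (ℚ.*≤* (subst₂ ℤ._≤_ (≡.sym (ℤ.*-identityʳ (+ m))) (≡.sym (ℤ.*-identityʳ (+ n))) (ℤ.+≤+ m≤n)))

ℕtoℚ-suc≢0 : ∀ d → ℕtoℚ (suc d) ≢ 0ℚ
ℕtoℚ-suc≢0 d eq = ℕ.1+n≢0 (ℕtoℚ-injective {suc d} {0} eq)

ℕtoℚ-suc-positive : ∀ d → ℚ.Positive (ℕtoℚ (suc d))
ℕtoℚ-suc-positive d = ℚ.normalize-pos (suc d) 1

2^-injective : ∀ a A → 2 ℕ.^ a ≡ 2 ℕ.^ A → a ≡ A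
2^-injective zero    zero    _  = refl
2^-injective zero    (suc A) eq with () ← ℕ.m*n≡1⇒m≡1 2 (2 ℕ.^ A) (≡.sym eq)
2^-injective (suc a) zero    eq with () ← ℕ.m*n≡1⇒m≡1 2 (2 ℕ.^ a) eq
2^-injective (suc a) (suc A) eq = cong suc (2^-injective a A (ℕ.*-cancelˡ-≡ (2 ℕ.^ a) (2 ℕ.^ A) 2 eq))

ℕtoℚ-2^ : ∀ n → ℕtoℚ (2 ℕ.^ n) ≡ (1ℚ + 1ℚ) ^ n
ℕtoℚ-2^ zero    = refl
ℕtoℚ-2^ (suc n) = trans (ℕtoℚ-* 2 (2 ℕ.^ n)) (cong ((1ℚ + 1ℚ) ·_) (ℕtoℚ-2^ n))

·-cancelʳ : ∀ {a b} c → c ≢ 0ℚ → a · c ≡ b · c → a ≡ b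
·-cancelʳ {a} {b} c c≢0 ac≡bc = begin
  a                       ≡⟨ ≡.sym (ℚ.*-identityʳ a) ⟩
  a · 1ℚ                  ≡⟨ cong (a ·_) (≡.sym c·c⁻¹≡1) ⟩
  a · (c · c⁻¹)           ≡⟨ ≡.sym (ℚ.*-assoc a c c⁻¹) ⟩
  (a · c) · c⁻¹           ≡⟨ cong (_· c⁻¹) ac≡bc ⟩
  (b · c) · c⁻¹           ≡⟨ ℚ.*-assoc b c c⁻¹ ⟩
  b · (c · c⁻¹)           ≡⟨ cong (b ·_) c·c⁻¹≡1 ⟩
  b · 1ℚ                  ≡⟨ ℚ.*-identityʳ b ⟩
  b                       ∎
  where
  open ≡-Reasoning
  instance
    c-nonZero : ℚ.NonZero c
    c-nonZero = ℚ.≢-nonZero c≢0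
  c⁻¹ : ℚ
  c⁻¹ = 1/ c
  c·c⁻¹≡1 : c · c⁻¹ ≡ 1ℚ
  c·c⁻¹≡1 = ℚ.*-inverseʳ c

·-zero-divisor : ∀ p q → p · q ≡ 0ℚ → p ≡ 0ℚ ⊎ q ≡ 0ℚ
·-zero-divisor p q pq≡0 with q ℚ.≟ 0ℚ
... | yes q≡0 = inj₂ q≡0
... | no  q≢0 = inj₁ (·-cancelʳ q q≢0 (trans pq≡0 (≡.sym (ℚ.*-zeroˡ q))))

/-·-ℕtoℚ : ∀ n d → (+ n / suc d) · ℕtoℚ (suc d) ≡ ℕtoℚ n
/-·-ℕtoℚ n d = ℚ.toℚᵘ-injective (begin
  ℚ.toℚᵘ ((+ n / suc d) · ℕtoℚ (suc d))             ≈⟨ ℚ.toℚᵘ-homo-* (+ n / suc d) (ℕtoℚ (suc d)) ⟩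
  ℚ.toℚᵘ (+ n / suc d) ℚᵘ.* ℚ.toℚᵘ (ℕtoℚ (suc d))   ≈⟨ ℚᵘ.*-cong (ℚ.toℚᵘ-fromℚᵘ (ℚᵘ.mkℚᵘ (+ n) d))
                                                                 (ℚ.toℚᵘ-fromℚᵘ (ℚᵘ.mkℚᵘ (+ suc d) 0)) ⟩
  ℚᵘ.mkℚᵘ (+ n) d ℚᵘ.* ℚᵘ.mkℚᵘ (+ suc d) 0          ≈⟨ ℚᵘ.*≡* cross ⟩
  ℚᵘ.mkℚᵘ (+ n) 0                                    ≈⟨ ℚ.toℚᵘ-fromℚᵘ (ℚᵘ.mkℚᵘ (+ n) 0) ⟨
  ℚ.toℚᵘ (ℕtoℚ n)                                    ∎)
  where
  open ℚᵘ.≃-Reasoning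
  cross : (+ n ℤ.* + suc d) ℤ.* + 1 ≡ + n ℤ.* + (suc d * 1)
  cross = trans (ℤ.*-identityʳ (+ n ℤ.* + suc d))
                (cong (λ k → + n ℤ.* + k) (≡.sym (ℕ.*-identityʳ (suc d))))

/-unique : ∀ {q} n d → q · ℕtoℚ (suc d) ≡ ℕtoℚ n → q ≡ + n / suc d
/-unique n d eq = ·-cancelʳ (ℕtoℚ (suc d)) (ℕtoℚ-suc≢0 d) (trans eq (≡.sym (/-·-ℕtoℚ n d)))

0≤/ : ∀ n d → 0ℚ ≤ℚ + n / suc d
0≤/ n d = ℚ.nonNegative⁻¹ (+ n / suc d) {{ℚ.normalize-nonNeg n (suc d)}}

0≤ℕtoℚ : ∀ n → 0ℚ ≤ℚ ℕtoℚ n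
0≤ℕtoℚ n = 0≤/ n 0

0≤-of-·-ℕtoℚ : ∀ {q} n d → q · ℕtoℚ (suc d) ≡ ℕtoℚ n → 0ℚ ≤ℚ q
0≤-of-·-ℕtoℚ n d eq = subst (0ℚ ≤ℚ_) (≡.sym (/-unique n d eq)) (0≤/ n d)

/-≤-ℕtoℚ : ∀ n q d → n ℕ.≤ q * suc d → + n / suc d ≤ℚ ℕtoℚ q
/-≤-ℕtoℚ n q d n≤qp = ℚ.*-cancelʳ-≤-pos (ℕtoℚ (suc d)) {{ℕtoℚ-suc-positive d}}
  (subst₂ _≤ℚ_ (≡.sym (/-·-ℕtoℚ n d)) (ℕtoℚ-* q (suc d)) (ℕtoℚ-mono-≤ n≤qp))

∣0-p∣ : ∀ {p} → 0ℚ ≤ℚ p → ∣ 0ℚ - p ∣ ≡ p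
∣0-p∣ {p} 0≤p =
  trans (cong ∣_∣ (ℚ.+-identityˡ (- p))) (trans (ℚ.∣-p∣≡∣p∣ p) (ℚ.0≤p⇒∣p∣≡p 0≤p))

minor : ∀ {n} → Matrix ℚ (suc n) → Fin (suc n) → Matrix ℚ n
minor M j a b = M (suc a) (punchIn j b)

laplaceTerm : ∀ n → Matrix ℚ (suc n) → Fin (suc n) → ℚ
laplaceTerm n M j = sign (toℕ j) · (M zero j · det n (minor M j))

det-cong : ∀ n {M N : Matrix ℚ n} → (∀ i j → M i j ≡ N i j) → det n M ≡ det n N
det-cong zero    M≗N = refl
det-cong (suc n) M≗N = ΣFin-cong (suc n) λ j →
  cong₂ (λ x y → sign (toℕ j) · (x · y)) (M≗N zero j) (det-cong n (λ a b → M≗N (suc a) (punchIn j b)))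

AgreeOffColumn : ∀ {n} → Fin n → Matrix ℚ n → Matrix ℚ n → Set
AgreeOffColumn c M N = ∀ i j → j ≢ c → M i j ≡ N i j

laplaceTerm-linear-at : ∀ n (M M₁ M₂ : Matrix ℚ (suc n)) (c : Fin (suc n)) (α β : ℚ) →
  AgreeOffColumn c M M₁ → AgreeOffColumn c M M₂ → M zero c ≡ α · M₁ zero c + β · M₂ zero c →
  laplaceTerm n M c ≡ α · laplaceTerm n M₁ c + β · laplaceTerm n M₂ c
laplaceTerm-linear-at n M M₁ M₂ c α β M≗M₁ M≗M₂ entry = begin
  s · (M zero c · D)
    ≡⟨ cong (λ x → s · (x · D)) entry ⟩
  s · ((α · M₁ zero c + β · M₂ zero c) · D)
    ≡⟨ split α β s (M₁ zero c) (M₂ zero c) D ⟩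
  α · (s · (M₁ zero c · D)) + β · (s · (M₂ zero c · D))
    ≡⟨ cong₂ (λ d₁ d₂ → α · (s · (M₁ zero c · d₁)) + β · (s · (M₂ zero c · d₂)))
         (det-cong n (λ a b → M≗M₁ (suc a) (punchIn c b) (Fin.punchInᵢ≢i c b)))
         (det-cong n (λ a b → M≗M₂ (suc a) (punchIn c b) (Fin.punchInᵢ≢i c b))) ⟩
  α · laplaceTerm n M₁ c + β · laplaceTerm n M₂ c
    ∎
  where
  open ≡-Reasoning
  s D : ℚ
  s = sign (toℕ c)
  D = det n (minor M c)
  split : ∀ α β s m₁ m₂ d →
    s · ((α · m₁ + β · m₂) · d) ≡ α · (s · (m₁ · d)) + β · (s · (m₂ · d))
  split = solve-∀ ℚ-ring

det-column-linear : ∀ n (M M₁ M₂ : Matrix ℚ n) (c : Fin n) (α β : ℚ) →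
  AgreeOffColumn c M M₁ → AgreeOffColumn c M M₂ → (∀ i → M i c ≡ α · M₁ i c + β · M₂ i c) →
  det n M ≡ α · det n M₁ + β · det n M₂
det-column-linear (suc n) M M₁ M₂ c α β M≗M₁ M≗M₂ column-c =
  trans (ΣFin-cong (suc n) term-linear) (ΣFin-linear (suc n) α β (laplaceTerm n M₁) (laplaceTerm n M₂))
  where
  term-linear : ∀ j → laplaceTerm n M j ≡ α · laplaceTerm n M₁ j + β · laplaceTerm n M₂ j
  term-linear j with j ≟ c
  ... | yes refl = laplaceTerm-linear-at n M M₁ M₂ j α β M≗M₁ M≗M₂ (column-c zero)
  ... | no  j≢c = begin
    s · (M zero j · det n (minor M j))
      ≡⟨ cong (λ d → s · (M zero j · d)) minor-linear ⟩
    s · (M zero j · (α · D₁ + β · D₂))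
      ≡⟨ split α β s (M zero j) D₁ D₂ ⟩
    α · (s · (M zero j · D₁)) + β · (s · (M zero j · D₂))
      ≡⟨ cong₂ (λ m₁ m₂ → α · (s · (m₁ · D₁)) + β · (s · (m₂ · D₂))) (M≗M₁ zero j j≢c) (M≗M₂ zero j j≢c) ⟩
    α · laplaceTerm n M₁ j + β · laplaceTerm n M₂ j
      ∎
    where
    open ≡-Reasoning
    s D₁ D₂ : ℚ
    s  = sign (toℕ j)
    D₁ = det n (minor M₁ j)
    D₂ = det n (minor M₂ j)
    split : ∀ α β s m d₁ d₂ →
      s · (m · (α · d₁ + β · d₂)) ≡ α · (s · (m · d₁)) + β · (s · (m · d₂))
    split = solve-∀ ℚ-ring
    c′ : Fin n
    c′ = punchOut j≢c
    punchIn-c′ : punchIn j c′ ≡ c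
    punchIn-c′ = Fin.punchIn-punchOut j≢c
    avoids-c : ∀ b → b ≢ c′ → punchIn j b ≢ c
    avoids-c b b≢c′ eq = b≢c′ (Fin.punchIn-injective j b c′ (trans eq (≡.sym punchIn-c′)))
    minor-linear : det n (minor M j) ≡ α · D₁ + β · D₂
    minor-linear = det-column-linear n (minor M j) (minor M₁ j) (minor M₂ j) c′ α β
      (λ a b b≢c′ → M≗M₁ (suc a) (punchIn j b) (avoids-c b b≢c′))
      (λ a b b≢c′ → M≗M₂ (suc a) (punchIn j b) (avoids-c b b≢c′))
      (λ a → subst (λ k → M (suc a) k ≡ α · M₁ (suc a) k + β · M₂ (suc a) k)
                   (≡.sym punchIn-c′) (column-c (suc a)))

det-zero-column : ∀ n (M : Matrix ℚ n) (c : Fin n) → (∀ i → M i c ≡ 0ℚ) → det n M ≡ 0ℚ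
det-zero-column n M c column-c≡0 =
  trans (det-column-linear n M M M c 0ℚ 0ℚ (λ _ _ _ → refl) (λ _ _ _ → refl)
           (λ i → trans (column-c≡0 i) (≡.sym (zero-combination (M i c)))))
        (zero-combination (det n M))
  where
  zero-combination : ∀ x → 0ℚ · x + 0ℚ · x ≡ 0ℚ
  zero-combination = solve-∀ ℚ-ring

punchIn-adjacent : ∀ {n} (t b : Fin (suc n)) →
  punchIn (inject₁ t) b ≡ punchIn (suc t) b ⊎
  (punchIn (inject₁ t) b ≡ suc t × punchIn (suc t) b ≡ inject₁ t)
punchIn-adjacent zero    zero    = inj₂ (refl , refl)
punchIn-adjacent zero    (suc b) = inj₁ refl
punchIn-adjacent {suc n} (suc t) zero    = inj₁ refl
punchIn-adjacent {suc n} (suc t) (suc b) with punchIn-adjacent t b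
... | inj₁ eq         = inj₁ (cong suc eq)
... | inj₂ (eq₁ , eq₂) = inj₂ (cong suc eq₁ , cong suc eq₂)

punchIn-onto-adjacent : ∀ {n} (t : Fin (suc n)) (j : Fin (suc (suc n))) → j ≢ inject₁ t → j ≢ suc t →
  Σ (Fin n) λ u → punchIn j (inject₁ u) ≡ inject₁ t × punchIn j (suc u) ≡ suc t
punchIn-onto-adjacent zero    zero          j≢t j≢t+1 = ⊥-elim (j≢t refl)
punchIn-onto-adjacent zero    (suc zero)    j≢t j≢t+1 = ⊥-elim (j≢t+1 refl)
punchIn-onto-adjacent {suc n} zero (suc (suc j)) j≢t j≢t+1 = zero , refl , refl
punchIn-onto-adjacent {suc n} (suc t) zero  j≢t j≢t+1 = t , refl , refl
punchIn-onto-adjacent {suc n} (suc t) (suc j) j≢t j≢t+1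
  with punchIn-onto-adjacent t j (j≢t ∘ cong suc) (j≢t+1 ∘ cong suc)
... | u , eq₁ , eq₂ = suc u , cong suc eq₁ , cong suc eq₂

ΣFin-adjacent-pair : ∀ n (g : Fin (suc (suc n)) → ℚ) (t : Fin (suc n)) →
  (∀ j → j ≢ inject₁ t → j ≢ suc t → g j ≡ 0ℚ) →
  g (inject₁ t) + g (suc t) ≡ 0ℚ → ΣFin (suc (suc n)) g ≡ 0ℚ
ΣFin-adjacent-pair n g zero g-elsewhere pair≡0 = begin
  ΣFin (suc (suc n)) g
    ≡⟨ ΣFin-suc (suc n) g ⟩
  g zero + ΣFin (suc n) (g ∘ suc)
    ≡⟨ cong (_+_ (g zero)) (ΣFin-suc n (g ∘ suc)) ⟩
  g zero + (g (suc zero) + ΣFin n (λ j → g (suc (suc j))))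
    ≡⟨ cong (λ s → g zero + (g (suc zero) + s))
         (ΣFin-zero n _ (λ j → g-elsewhere (suc (suc j)) (λ ()) (λ ()))) ⟩
  g zero + (g (suc zero) + 0ℚ)
    ≡⟨ cong (_+_ (g zero)) (ℚ.+-identityʳ (g (suc zero))) ⟩
  g zero + g (suc zero)
    ≡⟨ pair≡0 ⟩
  0ℚ
    ∎
  where open ≡-Reasoning
ΣFin-adjacent-pair (suc n) g (suc t) g-elsewhere pair≡0 = begin
  ΣFin (suc (suc (suc n))) g
    ≡⟨ ΣFin-suc (suc (suc n)) g ⟩
  g zero + ΣFin (suc (suc n)) (g ∘ suc)
    ≡⟨ cong₂ _+_ (g-elsewhere zero (λ ()) (λ ()))
         (ΣFin-adjacent-pair n (g ∘ suc) t
            (λ j p q → g-elsewhere (suc j) (p ∘ Fin.suc-injective) (q ∘ Fin.suc-injective)) pair≡0) ⟩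
  0ℚ + 0ℚ
    ≡⟨⟩
  0ℚ
    ∎
  where open ≡-Reasoning

-- In the expansion along row 0 the terms at t and t + 1 cancel (equal minors, opposite signs),
-- and every other minor again has two equal adjacent columns.
det-adjacent-equal-columns : ∀ n (M : Matrix ℚ (suc (suc n))) (t : Fin (suc n)) →
  (∀ i → M i (inject₁ t) ≡ M i (suc t)) → det (suc (suc n)) M ≡ 0ℚ

laplaceTerm-off-adjacent : ∀ n (M : Matrix ℚ (suc (suc n))) (t : Fin (suc n)) →
  (∀ i → M i (inject₁ t) ≡ M i (suc t)) →
  ∀ j → j ≢ inject₁ t → j ≢ suc t → laplaceTerm (suc n) M j ≡ 0ℚ
laplaceTerm-off-adjacent zero M t same j j≢t j≢t+1 with punchIn-onto-adjacent t j j≢t j≢t+1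
... | () , _
laplaceTerm-off-adjacent (suc n) M t same j j≢t j≢t+1 with punchIn-onto-adjacent t j j≢t j≢t+1
... | u , eq₁ , eq₂ =
  trans (cong (λ d → sign (toℕ j) · (M zero j · d)) (det-adjacent-equal-columns n (minor M j) u minor-same))
        (annihilate (sign (toℕ j)) (M zero j))
  where
  minor-same : ∀ a → minor M j a (inject₁ u) ≡ minor M j a (suc u)
  minor-same a = trans (cong (M (suc a)) eq₁) (trans (same (suc a)) (cong (M (suc a)) (≡.sym eq₂)))
  annihilate : ∀ s m → s · (m · 0ℚ) ≡ 0ℚ
  annihilate = solve-∀ ℚ-ring

det-adjacent-equal-columns n M t same =
  ΣFin-adjacent-pair n (laplaceTerm (suc n) M) t (laplaceTerm-off-adjacent n M t same) pair-cancels
  where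
  minors-agree : ∀ a b → minor M (inject₁ t) a b ≡ minor M (suc t) a b
  minors-agree a b with punchIn-adjacent t b
  ... | inj₁ eq         = cong (M (suc a)) eq
  ... | inj₂ (eq₁ , eq₂) =
    trans (cong (M (suc a)) eq₁) (trans (≡.sym (same (suc a))) (cong (M (suc a)) (≡.sym eq₂)))
  opposite : ∀ s m d → s · (m · d) + (- s) · (m · d) ≡ 0ℚ
  opposite = solve-∀ ℚ-ring
  pair-cancels : laplaceTerm (suc n) M (inject₁ t) + laplaceTerm (suc n) M (suc t) ≡ 0ℚ
  pair-cancels = trans
    (cong₂ (λ k d → sign k · (M zero (inject₁ t) · d) + laplaceTerm (suc n) M (suc t))
       (Fin.toℕ-inject₁ t) (det-cong (suc n) minors-agree))
    (trans (cong (λ m → sign (toℕ t) · (m · det (suc n) (minor M (suc t))) + laplaceTerm (suc n) M (suc t))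
                 (same zero))
       (opposite (sign (toℕ t)) (M zero (suc t)) (det (suc n) (minor M (suc t)))))

inject₁≢suc : ∀ {n} (t : Fin n) → inject₁ t ≢ suc t
inject₁≢suc t eq = ℕ.1+n≢n (≡.sym (trans (≡.sym (Fin.toℕ-inject₁ t)) (cong toℕ eq)))

det-add-adjacent-column : ∀ n (M N : Matrix ℚ (suc (suc n))) (t : Fin (suc n)) (c : ℚ) →
  AgreeOffColumn (suc t) N M →
  (∀ i → N i (suc t) ≡ M i (suc t) + c · M i (inject₁ t)) →
  det (suc (suc n)) N ≡ det (suc (suc n)) M
det-add-adjacent-column n M N t c N≗M column-t+1 = begin
  det (suc (suc n)) N
    ≡⟨ det-column-linear _ N M M′ (suc t) 1ℚ c N≗M N≗M′ column′ ⟩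
  1ℚ · det (suc (suc n)) M + c · det (suc (suc n)) M′
    ≡⟨ cong (λ d → 1ℚ · det (suc (suc n)) M + c · d) M′-singular ⟩
  1ℚ · det (suc (suc n)) M + c · 0ℚ
    ≡⟨ drop-zero (det (suc (suc n)) M) c ⟩
  det (suc (suc n)) M
    ∎
  where
  open ≡-Reasoning
  M′ : Matrix ℚ (suc (suc n))
  M′ i j = if eqᵇ j (suc t) then M i (inject₁ t) else M i j
  M′-off : ∀ i {j} → j ≢ suc t → M′ i j ≡ M i j
  M′-off i j≢t+1 = cong (λ e → if e then M i (inject₁ t) else M i _) (eqᵇ-≢ j≢t+1)
  M′-on : ∀ i → M′ i (suc t) ≡ M i (inject₁ t)
  M′-on i = cong (λ e → if e then M i (inject₁ t) else M i (suc t)) (eqᵇ-refl (suc t))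
  N≗M′ : AgreeOffColumn (suc t) N M′
  N≗M′ i j j≢t+1 = trans (N≗M i j j≢t+1) (≡.sym (M′-off i j≢t+1))
  column′ : ∀ i → N i (suc t) ≡ 1ℚ · M i (suc t) + c · M′ i (suc t)
  column′ i = trans (column-t+1 i)
    (cong₂ (λ x y → x + c · y) (≡.sym (ℚ.*-identityˡ (M i (suc t)))) (≡.sym (M′-on i)))
  M′-singular : det (suc (suc n)) M′ ≡ 0ℚ
  M′-singular = det-adjacent-equal-columns n M′ t λ i →
    trans (M′-off i (inject₁≢suc t)) (≡.sym (M′-on i))
  drop-zero : ∀ d c → 1ℚ · d + c · 0ℚ ≡ d
  drop-zero = solve-∀ ℚ-ring

det-pivot : ∀ n (M : Matrix ℚ (suc n)) → (∀ j → laplaceTerm n M (suc j) ≡ 0ℚ) →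
  det (suc n) M ≡ M zero zero · det n (minor M zero)
det-pivot n M tail≡0 = begin
  det (suc n) M
    ≡⟨ ΣFin-suc n (laplaceTerm n M) ⟩
  laplaceTerm n M zero + ΣFin n (laplaceTerm n M ∘ suc)
    ≡⟨ cong (_+_ (laplaceTerm n M zero)) (ΣFin-zero n _ tail≡0) ⟩
  1ℚ · (M zero zero · det n (minor M zero)) + 0ℚ
    ≡⟨ drop-unit (M zero zero · det n (minor M zero)) ⟩
  M zero zero · det n (minor M zero)
    ∎
  where
  open ≡-Reasoning
  drop-unit : ∀ x → 1ℚ · x + 0ℚ ≡ x
  drop-unit = solve-∀ ℚ-ring

det-row₀-pivot : ∀ n (M : Matrix ℚ (suc n)) → (∀ j → M zero (suc j) ≡ 0ℚ) →
  det (suc n) M ≡ M zero zero · det n (minor M zero)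
det-row₀-pivot n M row₀-tail≡0 = det-pivot n M λ j →
  trans (cong (λ m → sign (toℕ (suc j)) · (m · det n (minor M (suc j)))) (row₀-tail≡0 j))
        (annihilate (sign (toℕ (suc j))) (det n (minor M (suc j))))
  where
  annihilate : ∀ s d → s · (0ℚ · d) ≡ 0ℚ
  annihilate = solve-∀ ℚ-ring

det-column₀-pivot : ∀ n (M : Matrix ℚ (suc n)) → (∀ i → M (suc i) zero ≡ 0ℚ) →
  det (suc n) M ≡ M zero zero · det n (minor M zero)
det-column₀-pivot zero    M _               = det-pivot zero M λ ()
det-column₀-pivot (suc n) M column₀-tail≡0 = det-pivot (suc n) M λ j →
  trans (cong (λ d → sign (toℕ (suc j)) · (M zero (suc j) · d))
          (det-zero-column (suc n) (minor M (suc j)) zero column₀-tail≡0))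
        (annihilate (sign (toℕ (suc j))) (M zero (suc j)))
  where
  annihilate : ∀ s m → s · (m · 0ℚ) ≡ 0ℚ
  annihilate = solve-∀ ℚ-ring

-- Determinant of aI + bJ
-- Matrices given by a formula in the ℕ-indices: columns are addressed by index arithmetic, and
-- since δ is defined with _≡ᵇ_, the minor at (0, 0) is the shifted formula by definition.
toMatrix : ∀ {n} → (ℕ → ℕ → ℚ) → Matrix ℚ n
toMatrix F i j = F (toℕ i) (toℕ j)

det-add-adjacent-columnℕ : ∀ n (F G : ℕ → ℕ → ℚ) t (c : ℚ) → suc t ℕ.≤ n →
  (∀ i j → j ≢ suc t → G i j ≡ F i j) →
  (∀ i → G i (suc t) ≡ F i (suc t) + c · F i t) →
  det (suc n) (toMatrix G) ≡ det (suc n) (toMatrix F)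
det-add-adjacent-columnℕ (suc n) F G t c t<n G≗F column-t+1 =
  det-add-adjacent-column n (toMatrix F) (toMatrix G) u c
    (λ i j j≢u+1 → G≗F (toℕ i) (toℕ j) (j≢u+1 ∘ Fin.toℕ-injective ∘ λ eq → trans eq (cong suc (≡.sym toℕ-u))))
    column-u+1
  where
  u : Fin (suc n)
  u = fromℕ< t<n
  toℕ-u : toℕ u ≡ t
  toℕ-u = Fin.toℕ-fromℕ< t<n
  column-u+1 : ∀ i → toMatrix G i (suc u) ≡ toMatrix F i (suc u) + c · toMatrix F i (inject₁ u)
  column-u+1 i rewrite Fin.toℕ-inject₁ u | toℕ-u = column-t+1 (toℕ i)

differencesAbove : ℕ → (ℕ → ℕ → ℚ) → ℕ → ℕ → ℚ
differencesAbove t F i j = if does (j ℕ.≤? t) then F i j else F i j - F i (ℕ.pred j)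

differencesAbove-step : ∀ n F t → suc t ℕ.≤ n →
  det (suc n) (toMatrix (differencesAbove t F)) ≡ det (suc n) (toMatrix (differencesAbove (suc t) F))
differencesAbove-step n F t t<n =
  det-add-adjacent-columnℕ n (differencesAbove (suc t) F) (differencesAbove t F) t (- 1ℚ) t<n off-column on-column
  where
  same-test : ∀ j → j ≢ suc t → does (j ℕ.≤? t) ≡ does (j ℕ.≤? suc t)
  same-test j j≢t+1 with j ℕ.≤? t
  ... | yes j≤t = trans (dec-true (j ℕ.≤? t) j≤t) (≡.sym (dec-true (j ℕ.≤? suc t) (ℕ.m≤n⇒m≤1+n j≤t)))
  ... | no  j≰t = trans (dec-false (j ℕ.≤? t) j≰t)
                    (≡.sym (dec-false (j ℕ.≤? suc t) (λ j≤t+1 → j≢t+1 (ℕ.≤-antisym j≤t+1 (ℕ.≰⇒> j≰t)))))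
  off-column : ∀ i j → j ≢ suc t → differencesAbove t F i j ≡ differencesAbove (suc t) F i j
  off-column i j j≢t+1 = cong (λ e → if e then F i j else F i j - F i (ℕ.pred j)) (same-test j j≢t+1)
  subtract : ∀ x y → x - y ≡ x + (- 1ℚ) · y
  subtract = solve-∀ ℚ-ring
  on-column : ∀ i → differencesAbove t F i (suc t) ≡
    differencesAbove (suc t) F i (suc t) + (- 1ℚ) · differencesAbove (suc t) F i t
  on-column i rewrite dec-false (suc t ℕ.≤? t) (ℕ.n≮n t)
                    | dec-true (suc t ℕ.≤? suc t) ℕ.≤-refl
                    | dec-true (t ℕ.≤? suc t) (ℕ.n≤1+n t) = subtract (F i (suc t)) (F i t)

det-differencesAbove : ∀ n F t → t ℕ.≤ n →
  det (suc n) (toMatrix (differencesAbove 0 F)) ≡ det (suc n) (toMatrix (differencesAbove t F))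
det-differencesAbove n F zero    _   = refl
det-differencesAbove n F (suc t) t<n =
  trans (det-differencesAbove n F t (ℕ.<⇒≤ t<n)) (differencesAbove-step n F t t<n)

det-column-differences : ∀ n F →
  det (suc n) (toMatrix (differencesAbove 0 F)) ≡ det (suc n) (toMatrix F)
det-column-differences n F = trans (det-differencesAbove n F n ℕ.≤-refl) (det-cong (suc n) unchanged)
  where
  unchanged : ∀ i (j : Fin (suc n)) → differencesAbove n F (toℕ i) (toℕ j) ≡ F (toℕ i) (toℕ j)
  unchanged i j =
    cong (λ e → if e then F (toℕ i) (toℕ j) else F (toℕ i) (toℕ j) - F (toℕ i) (ℕ.pred (toℕ j)))
         (dec-true (toℕ j ℕ.≤? n) (ℕ.≤-pred (Fin.toℕ<n j)))

δ : ℕ → ℕ → ℚ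
δ i j = if i ≡ᵇ j then 1ℚ else 0ℚ

δ-refl : ∀ n → δ n n ≡ 1ℚ
δ-refl zero    = refl
δ-refl (suc n) = δ-refl n

δ-≢ : ∀ {m n} → m ≢ n → δ m n ≡ 0ℚ
δ-≢ {zero}  {zero}  m≢n = ⊥-elim (m≢n refl)
δ-≢ {zero}  {suc n} m≢n = refl
δ-≢ {suc m} {zero}  m≢n = refl
δ-≢ {suc m} {suc n} m≢n = δ-≢ (m≢n ∘ cong suc)

aI+bJ : ℚ → ℚ → ℕ → ℕ → ℚ
aI+bJ a b i j = a · δ i j + b

replaceColumn₀ : (ℕ → ℚ) → (ℕ → ℕ → ℚ) → ℕ → ℕ → ℚ
replaceColumn₀ v F i zero    = v i
replaceColumn₀ v F i (suc j) = F i (suc j)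

bidiagonal : ℚ → ℕ → ℕ → ℚ
bidiagonal a i j = a · δ i j - a · δ (suc i) j

det-bidiagonal : ∀ a n → det n (toMatrix (bidiagonal a)) ≡ a ^ n
det-bidiagonal a zero    = refl
det-bidiagonal a (suc n) = begin
  det (suc n) (toMatrix (bidiagonal a))
    ≡⟨ det-column₀-pivot n (toMatrix (bidiagonal a)) (λ _ → zero-entry a) ⟩
  (a · 1ℚ - a · 0ℚ) · det n (toMatrix (bidiagonal a))
    ≡⟨ cong₂ _·_ (diagonal-entry a) (det-bidiagonal a n) ⟩
  a · a ^ n
    ∎
  where
  open ≡-Reasoning
  zero-entry : ∀ a → a · 0ℚ - a · 0ℚ ≡ 0ℚ
  zero-entry = solve-∀ ℚ-ring
  diagonal-entry : ∀ a → a · 1ℚ - a · 0ℚ ≡ a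
  diagonal-entry = solve-∀ ℚ-ring

-- After replacing every column but the first by its difference with the previous one, the first
-- row is (b, 0, …, 0) and the remaining block is bidiagonal.
det-bordered : ∀ a b n → det (suc n) (toMatrix (replaceColumn₀ (λ _ → b) (aI+bJ a b))) ≡ b · a ^ n
det-bordered a b n = begin
  det (suc n) (toMatrix B)
    ≡⟨ ≡.sym (det-column-differences n B) ⟩
  det (suc n) (toMatrix (differencesAbove 0 B))
    ≡⟨ det-row₀-pivot n (toMatrix (differencesAbove 0 B)) (row₀-tail ∘ toℕ) ⟩
  b · det n (minor (toMatrix (differencesAbove 0 B)) zero)
    ≡⟨ cong (b ·_) (det-cong n (λ i j → minor-entry (toℕ i) (toℕ j))) ⟩
  b · det n (toMatrix (bidiagonal a))
    ≡⟨ cong (b ·_) (det-bidiagonal a n) ⟩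
  b · a ^ n
    ∎
  where
  open ≡-Reasoning
  B : ℕ → ℕ → ℚ
  B = replaceColumn₀ (λ _ → b) (aI+bJ a b)
  cancel₁ : ∀ a b → (a · 0ℚ + b) - b ≡ 0ℚ
  cancel₁ = solve-∀ ℚ-ring
  cancel₂ : ∀ a b → (a · 0ℚ + b) - (a · 0ℚ + b) ≡ 0ℚ
  cancel₂ = solve-∀ ℚ-ring
  row₀-tail : ∀ j → differencesAbove 0 B 0 (suc j) ≡ 0ℚ
  row₀-tail zero    = cancel₁ a b
  row₀-tail (suc j) = cancel₂ a b
  shift₁ : ∀ a b d → (a · d + b) - b ≡ a · d - a · 0ℚ
  shift₁ = solve-∀ ℚ-ring
  shift₂ : ∀ a b d e → (a · d + b) - (a · e + b) ≡ a · d - a · e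
  shift₂ = solve-∀ ℚ-ring
  minor-entry : ∀ i j → differencesAbove 0 B (suc i) (suc j) ≡ bidiagonal a i j
  minor-entry i zero    = shift₁ a b (δ i 0)
  minor-entry i (suc j) = shift₂ a b (δ i (suc j)) (δ i j)

det-aI+bJ-recurrence : ∀ a b n →
  det (suc n) (toMatrix (aI+bJ a b)) ≡ a · det n (toMatrix (aI+bJ a b)) + b · a ^ n
det-aI+bJ-recurrence a b n = begin
  det (suc n) (toMatrix (aI+bJ a b))
    ≡⟨ det-column-linear (suc n) (toMatrix (aI+bJ a b)) (toMatrix E₀) (toMatrix B) zero a 1ℚ
         off-column₀ off-column₀ column₀ ⟩
  a · det (suc n) (toMatrix E₀) + 1ℚ · det (suc n) (toMatrix B)
    ≡⟨ cong₂ (λ x y → a · x + 1ℚ · y) (det-column₀-pivot n (toMatrix E₀) (λ _ → refl)) (det-bordered a b n) ⟩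
  a · (1ℚ · det n (toMatrix (aI+bJ a b))) + 1ℚ · (b · a ^ n)
    ≡⟨ drop-units a (det n (toMatrix (aI+bJ a b))) (b · a ^ n) ⟩
  a · det n (toMatrix (aI+bJ a b)) + b · a ^ n
    ∎
  where
  open ≡-Reasoning
  E₀ B : ℕ → ℕ → ℚ
  E₀ = replaceColumn₀ (λ i → δ i 0) (aI+bJ a b)
  B  = replaceColumn₀ (λ _ → b) (aI+bJ a b)
  off-column₀ : ∀ {v} → AgreeOffColumn zero (toMatrix (aI+bJ a b)) (toMatrix {suc n} (replaceColumn₀ v (aI+bJ a b)))
  off-column₀ i zero    j≢0 = ⊥-elim (j≢0 refl)
  off-column₀ i (suc j) j≢0 = refl
  split : ∀ a b d → a · d + b ≡ a · d + 1ℚ · b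
  split = solve-∀ ℚ-ring
  column₀ : ∀ i → toMatrix (aI+bJ a b) i zero ≡ a · toMatrix E₀ i zero + 1ℚ · toMatrix B i zero
  column₀ i = split a b (δ (toℕ i) 0)
  drop-units : ∀ a d e → a · (1ℚ · d) + 1ℚ · e ≡ a · d + e
  drop-units = solve-∀ ℚ-ring

det-aI+bJ : ∀ a b n → det (suc n) (toMatrix (aI+bJ a b)) ≡ a ^ n · (a + ℕtoℚ (suc n) · b)
det-aI+bJ a b zero    = trans (det-aI+bJ-recurrence a b zero) (base a b)
  where
  base : ∀ a b → a · 1ℚ + b · 1ℚ ≡ 1ℚ · (a + 1ℚ · b)
  base = solve-∀ ℚ-ring
det-aI+bJ a b (suc n) = begin
  det (suc (suc n)) (toMatrix (aI+bJ a b))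
    ≡⟨ det-aI+bJ-recurrence a b (suc n) ⟩
  a · det (suc n) (toMatrix (aI+bJ a b)) + b · (a · a ^ n)
    ≡⟨ cong (λ d → a · d + b · (a · a ^ n)) (det-aI+bJ a b n) ⟩
  a · (a ^ n · (a + ℕtoℚ (suc n) · b)) + b · (a · a ^ n)
    ≡⟨ step a b (a ^ n) (ℕtoℚ (suc n)) ⟩
  (a · a ^ n) · (a + (1ℚ + ℕtoℚ (suc n)) · b)
    ≡⟨ cong (λ k → (a · a ^ n) · (a + k · b)) (≡.sym (ℕtoℚ-suc (suc n))) ⟩
  (a · a ^ n) · (a + ℕtoℚ (suc (suc n)) · b)
    ∎
  where
  open ≡-Reasoning
  step : ∀ a b p N → a · (p · (a + N · b)) + b · (a · p) ≡ (a · p) · (a + (1ℚ + N) · b)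
  step = solve-∀ ℚ-ring

charProd : List ℚ → ℚ → ℚ
charProd νs x = prodℚ (map (λ ν → x - ν) νs)

charProd-++ : ∀ xs ys x → charProd (xs ++ ys) x ≡ charProd xs x · charProd ys x
charProd-++ []       ys x = ≡.sym (ℚ.*-identityˡ (charProd ys x))
charProd-++ (ν ∷ xs) ys x =
  trans (cong ((x - ν) ·_) (charProd-++ xs ys x)) (≡.sym (ℚ.*-assoc (x - ν) (charProd xs x) (charProd ys x)))

charProd-replicate : ∀ A r x → charProd (replicate A r) x ≡ (x - r) ^ A
charProd-replicate zero    r x = refl
charProd-replicate (suc A) r x = cong ((x - r) ·_) (charProd-replicate A r x)

charProd-root : ∀ {ν νs} → ν ∈ νs → charProd νs ν ≡ 0ℚ
charProd-root {ν} {_ ∷ νs} (here refl) =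
  trans (cong (_· charProd νs ν) (ℚ.+-inverseʳ ν)) (ℚ.*-zeroˡ (charProd νs ν))
charProd-root {ν} {μ ∷ νs} (there ν∈νs) =
  trans (cong ((ν - μ) ·_) (charProd-root ν∈νs)) (ℚ.*-zeroʳ (ν - μ))

IsSpectrum-twoValued : ∀ {n} (M : Matrix ℚ n) A B r s → n ≡ A ℕ.+ B →
  (∀ x → charPolyAt M x ≡ (x - r) ^ A · (x - s) ^ B) →
  IsSpectrum M (replicate A r ++ replicate B s)
IsSpectrum-twoValued M A B r s n≡A+B charPoly = length-≡ , λ x → begin
  charPolyAt M x
    ≡⟨ charPoly x ⟩
  (x - r) ^ A · (x - s) ^ B
    ≡⟨ ≡.sym (cong₂ _·_ (charProd-replicate A r x) (charProd-replicate B s x)) ⟩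
  charProd (replicate A r) x · charProd (replicate B s) x
    ≡⟨ ≡.sym (charProd-++ (replicate A r) (replicate B s) x) ⟩
  charProd (replicate A r ++ replicate B s) x
    ∎
  where
  open ≡-Reasoning
  length-≡ : length (replicate A r ++ replicate B s) ≡ _
  length-≡ = trans (List.length-++ (replicate A r))
    (trans (cong₂ ℕ._+_ (List.length-replicate A) (List.length-replicate B)) (≡.sym n≡A+B))

^-zero : ∀ x n → x ^ n ≡ 0ℚ → x ≡ 0ℚ
^-zero x zero    1≡0 = ⊥-elim (ℚ.1≢0 1≡0)
^-zero x (suc n) xⁿ⁺¹≡0 with ·-zero-divisor x (x ^ n) xⁿ⁺¹≡0
... | inj₁ x≡0  = x≡0
... | inj₂ xⁿ≡0 = ^-zero x n xⁿ≡0

twoValued-of-charProd : ∀ νs A B r s → (∀ x → charProd νs x ≡ (x - r) ^ A · (x - s) ^ B) →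
  All (λ ν → ν ≡ r ⊎ ν ≡ s) νs
twoValued-of-charProd νs A B r s charProd≡ = All.tabulate λ {ν} ν∈νs →
  root ν (·-zero-divisor _ _ (trans (≡.sym (charProd≡ ν)) (charProd-root ν∈νs)))
  where
  root : ∀ ν → (ν - r) ^ A ≡ 0ℚ ⊎ (ν - s) ^ B ≡ 0ℚ → ν ≡ r ⊎ ν ≡ s
  root ν (inj₁ eq) = inj₁ (x∙y⁻¹≈ε⇒x≈y ν r (^-zero (ν - r) A eq))
  root ν (inj₂ eq) = inj₂ (x∙y⁻¹≈ε⇒x≈y ν s (^-zero (ν - s) B eq))

occurrences nonOccurrences : ℚ → List ℚ → ℕ
occurrences r []       = 0
occurrences r (ν ∷ νs) = if does (ν ℚ.≟ r) then suc (occurrences r νs) else occurrences r νs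
nonOccurrences r []       = 0
nonOccurrences r (ν ∷ νs) = if does (ν ℚ.≟ r) then nonOccurrences r νs else suc (nonOccurrences r νs)

module _ (r s : ℚ) where

  charProd-twoValued : ∀ νs → All (λ ν → ν ≡ r ⊎ ν ≡ s) νs →
    ∀ x → charProd νs x ≡ (x - r) ^ occurrences r νs · (x - s) ^ nonOccurrences r νs
  charProd-twoValued []       []         x = refl
  charProd-twoValued (ν ∷ νs) (ν∈ ∷ νs∈) x with ν ℚ.≟ r | ν∈
  ... | yes refl | _        =
    trans (cong ((x - ν) ·_) (charProd-twoValued νs νs∈ x))
          (≡.sym (ℚ.*-assoc (x - ν) ((x - ν) ^ occurrences ν νs) ((x - s) ^ nonOccurrences ν νs)))
  ... | no  ν≢r  | inj₁ ν≡r = ⊥-elim (ν≢r ν≡r)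
  ... | no  _    | inj₂ refl = trans (cong ((x - ν) ·_) (charProd-twoValued νs νs∈ x))
                                 (swap (x - ν) ((x - r) ^ occurrences r νs) ((x - ν) ^ nonOccurrences r νs))
    where
    swap : ∀ u p q → u · (p · q) ≡ p · (u · q)
    swap = solve-∀ ℚ-ring

  sum-twoValued : ∀ νs → All (λ ν → ν ≡ r ⊎ ν ≡ s) νs → ∀ (f : ℚ → ℚ) →
    sumℚ (map f νs) ≡ ℕtoℚ (occurrences r νs) · f r + ℕtoℚ (nonOccurrences r νs) · f s
  sum-twoValued []       []         f = solve-0 (f r) (f s)
    where
    solve-0 : ∀ y z → 0ℚ ≡ 0ℚ · y + 0ℚ · z
    solve-0 = solve-∀ ℚ-ring
  sum-twoValued (ν ∷ νs) (ν∈ ∷ νs∈) f with ν ℚ.≟ r | ν∈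
  ... | yes refl | _ = begin
    f ν + sumℚ (map f νs)                 ≡⟨ cong (_+_ (f ν)) (sum-twoValued νs νs∈ f) ⟩
    f ν + (ℕtoℚ a · f ν + ℕtoℚ b · f s)   ≡⟨ absorb-left (f ν) (f s) (ℕtoℚ a) (ℕtoℚ b) ⟩
    (1ℚ + ℕtoℚ a) · f ν + ℕtoℚ b · f s    ≡⟨ cong (λ k → k · f ν + ℕtoℚ b · f s) (≡.sym (ℕtoℚ-suc a)) ⟩
    ℕtoℚ (suc a) · f ν + ℕtoℚ b · f s     ∎
    where
    open ≡-Reasoning
    a = occurrences r νs
    b = nonOccurrences r νs
    absorb-left : ∀ y z A B → y + (A · y + B · z) ≡ (1ℚ + A) · y + B · z
    absorb-left = solve-∀ ℚ-ring
  ... | no  ν≢r  | inj₁ ν≡r = ⊥-elim (ν≢r ν≡r)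
  ... | no  _    | inj₂ refl = begin
    f ν + sumℚ (map f νs)                 ≡⟨ cong (_+_ (f ν)) (sum-twoValued νs νs∈ f) ⟩
    f ν + (ℕtoℚ a · f r + ℕtoℚ b · f ν)   ≡⟨ absorb-right (f r) (f ν) (ℕtoℚ a) (ℕtoℚ b) ⟩
    ℕtoℚ a · f r + (1ℚ + ℕtoℚ b) · f ν    ≡⟨ cong (λ k → ℕtoℚ a · f r + k · f ν) (≡.sym (ℕtoℚ-suc b)) ⟩
    ℕtoℚ a · f r + ℕtoℚ (suc b) · f ν     ∎
    where
    open ≡-Reasoning
    a = occurrences r νs
    b = nonOccurrences r νs
    absorb-right : ∀ y z A B → z + (A · y + B · z) ≡ A · y + (1ℚ + B) · z
    absorb-right = solve-∀ ℚ-ring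

length-occurrences : ∀ r νs → length νs ≡ occurrences r νs ℕ.+ nonOccurrences r νs
length-occurrences r []       = refl
length-occurrences r (ν ∷ νs) with ν ℚ.≟ r
... | yes _ = cong suc (length-occurrences r νs)
... | no  _ =
  trans (cong suc (length-occurrences r νs)) (≡.sym (ℕ.+-suc (occurrences r νs) (nonOccurrences r νs)))

-- At x₀ = 2s − r we have x₀ − r = 2(x₀ − s), so the identity reads 2ᵃ dᴺ = 2ᴬ dᴺ with d = s − r
-- and N = a + b = A + B.
multiplicities-unique : ∀ {r s} a b A B → r ≢ s → a ℕ.+ b ≡ A ℕ.+ B →
  (∀ x → (x - r) ^ a · (x - s) ^ b ≡ (x - r) ^ A · (x - s) ^ B) → a ≡ A
multiplicities-unique {r} {s} a b A B r≢s a+b≡A+B polynomials≡ =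
  2^-injective a A (ℕtoℚ-injective (trans (ℕtoℚ-2^ a) (trans 2^a≡2^A (≡.sym (ℕtoℚ-2^ A)))))
  where
  d x₀ : ℚ
  d  = s - r
  x₀ = s + d
  d≢0 : d ≢ 0ℚ
  d≢0 d≡0 = r≢s (≡.sym (x∙y⁻¹≈ε⇒x≈y s r d≡0))
  double : ∀ s r → (s + (s - r)) - r ≡ (1ℚ + 1ℚ) · (s - r)
  double = solve-∀ ℚ-ring
  single : ∀ s r → (s + (s - r)) - s ≡ s - r
  single = solve-∀ ℚ-ring
  at-x₀ : ∀ m n → (x₀ - r) ^ m · (x₀ - s) ^ n ≡ (1ℚ + 1ℚ) ^ m · d ^ (m ℕ.+ n)
  at-x₀ m n = begin
    (x₀ - r) ^ m · (x₀ - s) ^ n                  ≡⟨ cong₂ (λ u v → u ^ m · v ^ n) (double s r) (single s r) ⟩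
    ((1ℚ + 1ℚ) · d) ^ m · d ^ n                  ≡⟨ cong (_· d ^ n) (^-distrib-* (1ℚ + 1ℚ) d m) ⟩
    ((1ℚ + 1ℚ) ^ m · d ^ m) · d ^ n              ≡⟨ ℚ.*-assoc ((1ℚ + 1ℚ) ^ m) (d ^ m) (d ^ n) ⟩
    (1ℚ + 1ℚ) ^ m · (d ^ m · d ^ n)              ≡⟨ cong ((1ℚ + 1ℚ) ^ m ·_) (≡.sym (^-homo-* d m n)) ⟩
    (1ℚ + 1ℚ) ^ m · d ^ (m ℕ.+ n)                ∎
    where open ≡-Reasoning
  2^a≡2^A : (1ℚ + 1ℚ) ^ a ≡ (1ℚ + 1ℚ) ^ A
  2^a≡2^A = ·-cancelʳ (d ^ (A ℕ.+ B)) (d≢0 ∘ ^-zero d (A ℕ.+ B)) (begin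
    (1ℚ + 1ℚ) ^ a · d ^ (A ℕ.+ B)   ≡⟨ cong (λ k → (1ℚ + 1ℚ) ^ a · d ^ k) a+b≡A+B ⟨
    (1ℚ + 1ℚ) ^ a · d ^ (a ℕ.+ b)   ≡⟨ at-x₀ a b ⟨
    (x₀ - r) ^ a · (x₀ - s) ^ b     ≡⟨ polynomials≡ x₀ ⟩
    (x₀ - r) ^ A · (x₀ - s) ^ B     ≡⟨ at-x₀ A B ⟩
    (1ℚ + 1ℚ) ^ A · d ^ (A ℕ.+ B)   ∎)
    where open ≡-Reasoning

-- r ≡ s is allowed; it happens for K₂, whose CNL is zero.
sum-over-twoValued-spectrum : ∀ {n} (M : Matrix ℚ n) νs A B r s → IsSpectrum M νs → n ≡ A ℕ.+ B →
  (∀ x → charPolyAt M x ≡ (x - r) ^ A · (x - s) ^ B) →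
  ∀ f → sumℚ (map f νs) ≡ ℕtoℚ A · f r + ℕtoℚ B · f s
sum-over-twoValued-spectrum M νs A B r s (length≡n , charPoly≡charProd) n≡A+B charPoly f =
  trans (sum-twoValued r s νs values f) (by-cases (r ℚ.≟ s))
  where
  a b : ℕ
  a = occurrences r νs
  b = nonOccurrences r νs
  a+b≡A+B : a ℕ.+ b ≡ A ℕ.+ B
  a+b≡A+B = trans (≡.sym (length-occurrences r νs)) (trans length≡n n≡A+B)
  charProd≡ : ∀ x → charProd νs x ≡ (x - r) ^ A · (x - s) ^ B
  charProd≡ x = trans (≡.sym (charPoly≡charProd x)) (charPoly x)
  values : All (λ ν → ν ≡ r ⊎ ν ≡ s) νs
  values = twoValued-of-charProd νs A B r s charProd≡
  ℕtoℚ-+-· : ∀ m n y → ℕtoℚ (m ℕ.+ n) · y ≡ ℕtoℚ m · y + ℕtoℚ n · y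
  ℕtoℚ-+-· m n y = trans (cong (_· y) (ℕtoℚ-+ m n)) (ℚ.*-distribʳ-+ y (ℕtoℚ m) (ℕtoℚ n))
  by-cases : Dec (r ≡ s) → ℕtoℚ a · f r + ℕtoℚ b · f s ≡ ℕtoℚ A · f r + ℕtoℚ B · f s
  by-cases (yes r≡s) = begin
    ℕtoℚ a · f r + ℕtoℚ b · f s    ≡⟨ cong (λ z → ℕtoℚ a · f z + ℕtoℚ b · f s) r≡s ⟩
    ℕtoℚ a · f s + ℕtoℚ b · f s    ≡⟨ ℕtoℚ-+-· a b (f s) ⟨
    ℕtoℚ (a ℕ.+ b) · f s           ≡⟨ cong (λ k → ℕtoℚ k · f s) a+b≡A+B ⟩
    ℕtoℚ (A ℕ.+ B) · f s           ≡⟨ ℕtoℚ-+-· A B (f s) ⟩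
    ℕtoℚ A · f s + ℕtoℚ B · f s    ≡⟨ cong (λ z → ℕtoℚ A · f z + ℕtoℚ B · f s) r≡s ⟨
    ℕtoℚ A · f r + ℕtoℚ B · f s    ∎
    where open ≡-Reasoning
  by-cases (no r≢s) = cong₂ (λ m n → ℕtoℚ m · f r + ℕtoℚ n · f s) a≡A b≡B
    where
    a≡A : a ≡ A
    a≡A = multiplicities-unique a b A B r≢s a+b≡A+B λ x →
      trans (≡.sym (charProd-twoValued r s νs values x)) (charProd≡ x)
    b≡B : b ≡ B
    b≡B = ℕ.+-cancelˡ-≡ A b B (trans (cong (ℕ._+ b) (≡.sym a≡A)) a+b≡A+B)

charMatrix : ∀ {n} → Matrix ℚ n → ℚ → Matrix ℚ n
charMatrix M x i j = (if eqᵇ i j then x else 0ℚ) - M i j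

charMatrix-CNL : ∀ {n} (G : SimpleGraph n) x i j {ρ w} →
  CNrowSum G i ≡ ρ → (i ≢ j → commonNbrs G i j ≡ w) →
  charMatrix (CNL G) x i j ≡ aI+bJ (x - ℕtoℚ (ρ ℕ.+ w)) (ℕtoℚ w) (toℕ i) (toℕ j)
charMatrix-CNL G x i j {ρ} {w} rowSum≡ρ common≡w with i ≟ j
... | yes refl rewrite rowSum≡ρ | δ-refl (toℕ i) | ℕtoℚ-+ ρ w =
  diagonal x (ℕtoℚ ρ) (ℕtoℚ w)
  where
  diagonal : ∀ x P W → x - (P - 0ℚ) ≡ (x - (P + W)) · 1ℚ + W
  diagonal = solve-∀ ℚ-ring
... | no  i≢j rewrite common≡w i≢j | δ-≢ (i≢j ∘ Fin.toℕ-injective) =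
  off-diagonal x (ℕtoℚ (ρ ℕ.+ w)) (ℕtoℚ w)
  where
  off-diagonal : ∀ x Q W → 0ℚ - (0ℚ - W) ≡ (x - Q) · 0ℚ + W
  off-diagonal = solve-∀ ℚ-ring

star-commonNbrs-center-leaf : ∀ k (j : Fin k) → commonNbrs (star k) zero (suc j) ≡ 0
star-commonNbrs-center-leaf k j =
  trans (ΣFinℕ-suc k (λ v → if starAdj zero v ∧ starAdj v (suc j) then 1 else 0)) (ΣFinℕ-zero k (λ _ → refl))

star-commonNbrs-leaf-center : ∀ k (a : Fin k) → commonNbrs (star k) (suc a) zero ≡ 0
star-commonNbrs-leaf-center k a =
  trans (ΣFinℕ-suc k (λ v → if starAdj (suc a) v ∧ starAdj v zero then 1 else 0)) (ΣFinℕ-zero k (λ _ → refl))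

star-commonNbrs-leaf-leaf : ∀ k (a b : Fin k) → commonNbrs (star k) (suc a) (suc b) ≡ 1
star-commonNbrs-leaf-leaf k a b =
  trans (ΣFinℕ-suc k (λ v → if starAdj (suc a) v ∧ starAdj v (suc b) then 1 else 0))
        (cong suc (ΣFinℕ-zero k (λ _ → refl)))

star-rowSum-center : ∀ k → CNrowSum (star k) zero ≡ 0
star-rowSum-center k = trans (ΣFinℕ-suc k (CN (star k) zero)) (ΣFinℕ-zero k (star-commonNbrs-center-leaf k))

star-rowSum-leaf : ∀ m (a : Fin (suc m)) → CNrowSum (star (suc m)) (suc a) ≡ m
star-rowSum-leaf m a = begin
  CNrowSum (star (suc m)) (suc a)
    ≡⟨ ΣFinℕ-suc (suc m) (CN (star (suc m)) (suc a)) ⟩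
  commonNbrs (star (suc m)) (suc a) zero ℕ.+ ΣFinℕ (suc m) (CN (star (suc m)) (suc a) ∘ suc)
    ≡⟨ cong₂ ℕ._+_ (star-commonNbrs-leaf-center (suc m) a) (ΣFinℕ-cong (suc m) leaf-entry) ⟩
  ΣFinℕ (suc m) (λ b → if eqᵇ a b then 0 else 1)
    ≡⟨ ΣFinℕ-off-diagonal m a 1 ⟩
  m * 1
    ≡⟨ ℕ.*-identityʳ m ⟩
  m ∎
  where
  open ≡-Reasoning
  leaf-entry : ∀ b → CN (star (suc m)) (suc a) (suc b) ≡ (if eqᵇ a b then 0 else 1)
  leaf-entry b = trans (cong (λ e → if e then 0 else commonNbrs (star (suc m)) (suc a) (suc b)) (eqᵇ-suc a b))
                       (cong (λ c → if eqᵇ a b then 0 else c) (star-commonNbrs-leaf-leaf (suc m) a b))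

star-trace : ∀ m → trCNRS (star (suc m)) ≡ suc m * m
star-trace m = trans (ΣFinℕ-suc (suc m) (CNrowSum (star (suc m))))
  (cong₂ ℕ._+_ (star-rowSum-center (suc m)) (ΣFinℕ-const (suc m) m (star-rowSum-leaf m)))

star-charPoly : ∀ m x → charPolyAt (CNL (star (suc m))) x ≡ (x - 0ℚ) ^ 2 · (x - ℕtoℚ (suc m)) ^ m
star-charPoly m x = begin
  det (suc (suc m)) (charMatrix (CNL (star (suc m))) x)
    ≡⟨ det-row₀-pivot (suc m) (charMatrix (CNL (star (suc m))) x) row₀-tail ⟩
  charMatrix (CNL (star (suc m))) x zero zero · det (suc m) (minor (charMatrix (CNL (star (suc m))) x) zero)
    ≡⟨ cong₂ _·_ corner (det-cong (suc m) leaves) ⟩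
  x · det (suc m) (toMatrix (aI+bJ (x - k) (ℕtoℚ 1)))
    ≡⟨ cong (x ·_) (det-aI+bJ (x - k) (ℕtoℚ 1) m) ⟩
  x · ((x - k) ^ m · ((x - k) + k · 1ℚ))
    ≡⟨ rearrange x k ((x - k) ^ m) ⟩
  (x - 0ℚ) ^ 2 · (x - k) ^ m
    ∎
  where
  open ≡-Reasoning
  k : ℚ
  k = ℕtoℚ (suc m)
  row₀-tail : ∀ j → charMatrix (CNL (star (suc m))) x zero (suc j) ≡ 0ℚ
  row₀-tail j rewrite star-commonNbrs-center-leaf (suc m) j = refl
  corner : charMatrix (CNL (star (suc m))) x zero zero ≡ x
  corner rewrite star-rowSum-center (suc m) = ℚ.+-identityʳ x
  leaves : ∀ a b → charMatrix (CNL (star (suc m))) x (suc a) (suc b) ≡ aI+bJ (x - k) (ℕtoℚ 1) (toℕ a) (toℕ b)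
  leaves a b = trans (charMatrix-CNL (star (suc m)) x (suc a) (suc b) (star-rowSum-leaf m a)
                        (λ _ → star-commonNbrs-leaf-leaf (suc m) a b))
                     (cong (λ n → aI+bJ (x - ℕtoℚ n) (ℕtoℚ 1) (toℕ a) (toℕ b)) (ℕ.+-comm m 1))
  rearrange : ∀ x k p → x · (p · ((x - k) + k · 1ℚ)) ≡ ((x - 0ℚ) · ((x - 0ℚ) · 1ℚ)) · p
  rearrange = solve-∀ ℚ-ring

complete-commonNbrs : ∀ m (i j : Fin (suc (suc m))) → i ≢ j → commonNbrs (complete (suc (suc m))) i j ≡ m
complete-commonNbrs m i j i≢j = ℕ.suc-injective (begin
  suc (commonNbrs K i j)
    ≡⟨ cong (ℕ._+ commonNbrs K i j) (ΣFinℕ-indicator (suc (suc m)) j) ⟨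
  ΣFinℕ (suc (suc m)) indicator ℕ.+ ΣFinℕ (suc (suc m)) common
    ≡⟨ ΣFinℕ-+ (suc (suc m)) indicator common ⟨
  ΣFinℕ (suc (suc m)) (λ v → indicator v ℕ.+ common v)
    ≡⟨ ΣFinℕ-cong (suc (suc m)) pointwise ⟩
  ΣFinℕ (suc (suc m)) (λ v → if eqᵇ i v then 0 else 1)
    ≡⟨ ΣFinℕ-off-diagonal (suc m) i 1 ⟩
  suc m * 1
    ≡⟨ ℕ.*-identityʳ (suc m) ⟩
  suc m ∎)
  where
  open ≡-Reasoning
  K : SimpleGraph (suc (suc m))
  K = complete (suc (suc m))
  indicator common : Fin (suc (suc m)) → ℕ
  indicator v = if eqᵇ v j then 1 else 0
  common v = if not (eqᵇ i v) ∧ not (eqᵇ v j) then 1 else 0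
  pointwise : ∀ v → indicator v ℕ.+ common v ≡ (if eqᵇ i v then 0 else 1)
  pointwise v with v ≟ j
  ... | yes refl rewrite eqᵇ-≢ i≢j = refl
  ... | no  _ with eqᵇ i v
  ...   | true  = refl
  ...   | false = refl

complete-rowSum : ∀ m (i : Fin (suc (suc m))) → CNrowSum (complete (suc (suc m))) i ≡ suc m * m
complete-rowSum m i = trans (ΣFinℕ-cong (suc (suc m)) entry) (ΣFinℕ-off-diagonal (suc m) i m)
  where
  entry : ∀ j → CN (complete (suc (suc m))) i j ≡ (if eqᵇ i j then 0 else m)
  entry j with i ≟ j
  ... | yes _   = refl
  ... | no  i≢j = complete-commonNbrs m i j i≢j

complete-trace : ∀ m → trCNRS (complete (suc (suc m))) ≡ suc (suc m) * (suc m * m)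
complete-trace m = ΣFinℕ-const (suc (suc m)) (suc m * m) (complete-rowSum m)

complete-charPoly : ∀ m x →
  charPolyAt (CNL (complete (suc (suc m)))) x ≡ (x - 0ℚ) ^ 1 · (x - ℕtoℚ (suc (suc m) * m)) ^ suc m
complete-charPoly m x = begin
  det (suc (suc m)) (charMatrix (CNL (complete (suc (suc m)))) x)
    ≡⟨ det-cong (suc (suc m)) entries ⟩
  det (suc (suc m)) (toMatrix (aI+bJ (x - S) (ℕtoℚ m)))
    ≡⟨ det-aI+bJ (x - S) (ℕtoℚ m) (suc m) ⟩
  (x - S) ^ suc m · ((x - S) + P · ℕtoℚ m)
    ≡⟨ cong (λ s → (x - S) ^ suc m · ((x - S) + s)) (≡.sym (ℕtoℚ-* (suc (suc m)) m)) ⟩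
  (x - S) ^ suc m · ((x - S) + S)
    ≡⟨ rearrange x S ((x - S) ^ suc m) ⟩
  (x - 0ℚ) ^ 1 · (x - S) ^ suc m
    ∎
  where
  open ≡-Reasoning
  S P : ℚ
  S = ℕtoℚ (suc (suc m) * m)
  P = ℕtoℚ (suc (suc m))
  diagonal-shift : suc m * m ℕ.+ m ≡ suc (suc m) * m
  diagonal-shift = ℕ.+-comm (suc m * m) m
  entries : ∀ i j → charMatrix (CNL (complete (suc (suc m)))) x i j ≡ aI+bJ (x - S) (ℕtoℚ m) (toℕ i) (toℕ j)
  entries i j = trans
    (charMatrix-CNL (complete (suc (suc m))) x i j (complete-rowSum m i) (complete-commonNbrs m i j))
    (cong (λ n → aI+bJ (x - ℕtoℚ n) (ℕtoℚ m) (toℕ i) (toℕ j)) diagonal-shift)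
  rearrange : ∀ x S p → p · ((x - S) + S) ≡ ((x - 0ℚ) · 1ℚ) · p
  rearrange = solve-∀ ℚ-ring

meanRowSum : ∀ {m} → SimpleGraph (suc m) → ℚ
meanRowSum {m} G = + trCNRS G / suc m

LE-sum : ∀ {m} → SimpleGraph (suc m) → List ℚ → ℚ
LE-sum G νs = sumℚ (map (λ ν → ∣ ν - meanRowSum G ∣) νs)

star-meanRowSum : ∀ m → meanRowSum (star (suc m)) · ℕtoℚ (suc (suc m)) ≡ ℕtoℚ (suc m * m)
star-meanRowSum m = trans (/-·-ℕtoℚ (trCNRS (star (suc m))) (suc m)) (cong ℕtoℚ (star-trace m))

star-leaf-gap : ∀ m → (ℕtoℚ (suc m) - meanRowSum (star (suc m))) · ℕtoℚ (suc (suc m)) ≡ ℕtoℚ (2 * suc m)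
star-leaf-gap m = begin
  (k - c) · p
    ≡⟨ distribʳ k c p ⟩
  k · p - c · p
    ≡⟨ cong₂ _-_ (≡.sym (ℕtoℚ-* (suc m) (suc (suc m)))) (star-meanRowSum m) ⟩
  ℕtoℚ (suc m * suc (suc m)) - ℕtoℚ (suc m * m)
    ≡⟨ cong (λ n → ℕtoℚ n - ℕtoℚ (suc m * m)) (k·p m) ⟩
  ℕtoℚ (suc m * m ℕ.+ 2 * suc m) - ℕtoℚ (suc m * m)
    ≡⟨ cong (_- ℕtoℚ (suc m * m)) (ℕtoℚ-+ (suc m * m) (2 * suc m)) ⟩
  (ℕtoℚ (suc m * m) + ℕtoℚ (2 * suc m)) - ℕtoℚ (suc m * m)
    ≡⟨ cancel (ℕtoℚ (suc m * m)) (ℕtoℚ (2 * suc m)) ⟩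
  ℕtoℚ (2 * suc m)
    ∎
  where
  open ≡-Reasoning
  k c p : ℚ
  k = ℕtoℚ (suc m)
  c = meanRowSum (star (suc m))
  p = ℕtoℚ (suc (suc m))
  k·p : ∀ m → suc m * suc (suc m) ≡ suc m * m ℕ.+ 2 * suc m
  k·p = ℕ-Solver.solve-∀
  distribʳ : ∀ k c p → (k - c) · p ≡ k · p - c · p
  distribʳ = solve-∀ ℚ-ring
  cancel : ∀ a b → (a + b) - a ≡ b
  cancel = solve-∀ ℚ-ring

star-LE : ∀ m νs → IsSpectrum (CNL (star (suc m))) νs →
  LE-sum (star (suc m)) νs ≡ + (4 * suc m * m) / suc (suc m)
star-LE m νs spectrum = begin
  LE-sum (star (suc m)) νs
    ≡⟨ sum-over-twoValued-spectrum (CNL (star (suc m))) νs 2 m 0ℚ k spectrum refl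
         (star-charPoly m) (λ ν → ∣ ν - c ∣) ⟩
  ℕtoℚ 2 · ∣ 0ℚ - c ∣ + ℕtoℚ m · ∣ k - c ∣
    ≡⟨ cong₂ (λ u v → ℕtoℚ 2 · u + ℕtoℚ m · v)
         (∣0-p∣ (0≤/ (trCNRS (star (suc m))) (suc m)))
         (ℚ.0≤p⇒∣p∣≡p (0≤-of-·-ℕtoℚ (2 * suc m) (suc m) (star-leaf-gap m))) ⟩
  ℕtoℚ 2 · c + ℕtoℚ m · (k - c)
    ≡⟨ /-unique (4 * suc m * m) (suc m) (begin
         (ℕtoℚ 2 · c + ℕtoℚ m · (k - c)) · p                    ≡⟨ distribute (ℕtoℚ 2) c (ℕtoℚ m) (k - c) p ⟩
         ℕtoℚ 2 · (c · p) + ℕtoℚ m · ((k - c) · p)              ≡⟨ cong₂ (λ u v → ℕtoℚ 2 · u + ℕtoℚ m · v)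
                                                                      (star-meanRowSum m) (star-leaf-gap m) ⟩
         ℕtoℚ 2 · ℕtoℚ (suc m * m) + ℕtoℚ m · ℕtoℚ (2 * suc m)  ≡⟨ ℕtoℚ-linear 2 (suc m * m) m (2 * suc m) ⟩
         ℕtoℚ (2 * (suc m * m) ℕ.+ m * (2 * suc m))             ≡⟨ cong ℕtoℚ (energy m) ⟩
         ℕtoℚ (4 * suc m * m)                                   ∎) ⟩
  + (4 * suc m * m) / suc (suc m)
    ∎
  where
  open ≡-Reasoning
  c k p : ℚ
  c = meanRowSum (star (suc m))
  k = ℕtoℚ (suc m)
  p = ℕtoℚ (suc (suc m))
  distribute : ∀ a c b g p → (a · c + b · g) · p ≡ a · (c · p) + b · (g · p)
  distribute = solve-∀ ℚ-ring
  energy : ∀ m → 2 * (suc m * m) ℕ.+ m * (2 * suc m) ≡ 4 * suc m * m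
  energy = ℕ-Solver.solve-∀

complete-meanRowSum : ∀ m → meanRowSum (complete (suc (suc m))) ≡ ℕtoℚ (suc m * m)
complete-meanRowSum m = ≡.sym (/-unique (trCNRS (complete (suc (suc m)))) (suc m)
  (trans (≡.sym (ℕtoℚ-* (suc m * m) (suc (suc m))))
    (cong ℕtoℚ (trans (ℕ.*-comm (suc m * m) (suc (suc m))) (≡.sym (complete-trace m))))))

complete-LE : ∀ m νs → IsSpectrum (CNL (complete (suc (suc m)))) νs →
  LE-sum (complete (suc (suc m))) νs ≡ ℕtoℚ (2 * (suc m * m))
complete-LE m νs spectrum = begin
  LE-sum (complete (suc (suc m))) νs
    ≡⟨ sum-over-twoValued-spectrum (CNL (complete (suc (suc m)))) νs 1 (suc m) 0ℚ s spectrum refl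
         (complete-charPoly m) (λ ν → ∣ ν - c ∣) ⟩
  ℕtoℚ 1 · ∣ 0ℚ - c ∣ + ℕtoℚ (suc m) · ∣ s - c ∣
    ≡⟨ cong (λ c → ℕtoℚ 1 · ∣ 0ℚ - c ∣ + ℕtoℚ (suc m) · ∣ s - c ∣) (complete-meanRowSum m) ⟩
  ℕtoℚ 1 · ∣ 0ℚ - r ∣ + ℕtoℚ (suc m) · ∣ s - r ∣
    ≡⟨ cong₂ (λ u v → ℕtoℚ 1 · u + ℕtoℚ (suc m) · v)
         (∣0-p∣ (0≤ℕtoℚ (suc m * m))) (trans (cong ∣_∣ gap) (ℚ.0≤p⇒∣p∣≡p (0≤ℕtoℚ m))) ⟩
  ℕtoℚ 1 · r + ℕtoℚ (suc m) · ℕtoℚ m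
    ≡⟨ ℕtoℚ-linear 1 (suc m * m) (suc m) m ⟩
  ℕtoℚ (1 * (suc m * m) ℕ.+ suc m * m)
    ≡⟨ cong ℕtoℚ (energy m) ⟩
  ℕtoℚ (2 * (suc m * m))
    ∎
  where
  open ≡-Reasoning
  c r s : ℚ
  c = meanRowSum (complete (suc (suc m)))
  r = ℕtoℚ (suc m * m)
  s = ℕtoℚ (suc (suc m) * m)
  cancel : ∀ a b → (a + b) - b ≡ a
  cancel = solve-∀ ℚ-ring
  gap : s - r ≡ ℕtoℚ m
  gap = trans (cong (_- r) (ℕtoℚ-+ m (suc m * m))) (cancel (ℕtoℚ m) r)
  energy : ∀ m → 1 * (suc m * m) ℕ.+ suc m * m ≡ 2 * (suc m * m)
  energy = ℕ-Solver.solve-∀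

star-LE≤complete-LE : ∀ m → + (4 * suc m * m) / suc (suc m) ≤ℚ ℕtoℚ (2 * (suc m * m))
star-LE≤complete-LE m = /-≤-ℕtoℚ (4 * suc m * m) (2 * (suc m * m)) (suc m)
  (subst (4 * suc m * m ℕ.≤_) (≡.sym (expand m)) (ℕ.m≤m+n (4 * suc m * m) (2 * (suc m * m) * m)))
  where
  expand : ∀ m → 2 * (suc m * m) * suc (suc m) ≡ 4 * suc m * m ℕ.+ 2 * (suc m * m) * m
  expand = ℕ-Solver.solve-∀

star-spectrum : ∀ m → IsSpectrum (CNL (star (suc m))) (replicate 2 0ℚ ++ replicate m (ℕtoℚ (suc m)))
star-spectrum m = IsSpectrum-twoValued (CNL (star (suc m))) 2 m 0ℚ (ℕtoℚ (suc m)) refl (star-charPoly m)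

star-not-CNLHyperenergetic : ∀ m → ¬ CNLHyperenergetic (star (suc m))
star-not-CNLHyperenergetic m (e₁ , e₂ , (νs , spectrum , e₁≡) , (μs , spectrumK , e₂≡) , e₂<e₁) =
  ℚ.<-irrefl refl (ℚ.<-≤-trans e₂<e₁ e₁≤e₂)
  where
  e₁≤e₂ : e₁ ≤ℚ e₂
  e₁≤e₂ = subst₂ _≤ℚ_
    (≡.sym (trans e₁≡ (star-LE m νs spectrum)))
    (≡.sym (trans e₂≡ (complete-LE m μs spectrumK)))
    (star-LE≤complete-LE m)

corollary3p5 : (k : ℕ) → 1 ≤ k →
    IsSpectrum (CNL (star k)) (replicate 2 0ℚ ++ replicate (k ∸ 1) (ℕtoℚ k))
    × HasLE_CN (star k) (+ (4 * k * (k ∸ 1)) / suc k)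
    × ¬ CNLHyperenergetic (star k)
corollary3p5 (suc m) _ =
  star-spectrum m ,
  (eigenvalues , star-spectrum m , ≡.sym (star-LE m eigenvalues (star-spectrum m))) ,
  star-not-CNLHyperenergetic m
  where
  eigenvalues : List ℚ
  eigenvalues = replicate 2 0ℚ ++ replicate m (ℕtoℚ (suc m))
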